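{- Let $G=([n]\cup[n]',E)$ be a monotone graph in its monotone labelling. Then $G$ contains a perfect matching if and only if it contains the diagonal matching $\delta=\{(i,i'):i\in[n]\}$, i.e., $(i,i')\in E$ for all $i\in[n]$.
   Context: $[n]=\{1,\dots,n\}$ and $[n]'=\{1',\dots,n'\}$. A bipartite graph $G=([n]\cup[n]',E)$ is in monotone labelling if for every $i\in[n]$ the neighbourhood $\mathcal N(i)$ is an interval $[\alpha'_i,\beta'_i]$ of consecutive elements of $[n]'$, with $\alpha'_i\le\alpha'_j$ and $\beta'_i\le\beta'_j$ whenever $i<j$. -}

module Defs where

open import Level using (0ℓ)
open import Data.Nat using (ℕ)
open import Data.Fin using (Fin; _≤_; _<_)
open import Data.Product using (Σ; _×_; ∃)
open import Function.Bundles using (_↔_; Inverse)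
open import Relation.Binary.PropositionalEquality using (_≡_)

-- A bipartite graph on [n] ∪ [n]' : left vertices Fin n, right vertices Fin n
-- (right vertex j stands for j'), given by its edge relation.
BipGraph : ℕ → Set₁
BipGraph n = Fin n → Fin n → Set

record MonotoneLabelling {n : ℕ} (E : BipGraph n) : Set where
  field
    α β      : Fin n → Fin n
    interval : ∀ i j → (E i j → (α i ≤ j × j ≤ β i)) × ((α i ≤ j × j ≤ β i) → E i j)
    α-mono   : ∀ i j → i < j → α i ≤ α j
    β-mono   : ∀ i j → i < j → β i ≤ β j

PerfectMatching : {n : ℕ} → BipGraph n → Set
PerfectMatching {n} E = Σ (Fin n ↔ Fin n) λ σ → ∀ i → E i (Inverse.to σ i)

ContainsDiagonal : {n : ℕ} → BipGraph n → Set
ContainsDiagonal {n} E = ∀ (i : Fin n) → E i i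

module Submission where

-- A matching σ has, for every i, a pivot j ≤ i with i ≤ σ j (an injection cannot squeeze
-- the j ≤ i into the right vertices below i); hence i ≤ σ j ≤ β j ≤ β i.  Dually σ⁻¹ has
-- a pivot j ≤ i with i ≤ k := σ⁻¹ j, and (k , j) ∈ E gives α i ≤ α k ≤ j ≤ i.  So every
-- i lies in its own interval [α i , β i].

open import Defs
open import Data.Nat using (ℕ)
import Data.Nat.Properties as ℕ
open import Data.Fin using (Fin; _≤_; _<_)
open import Data.Fin.Properties using (≤-refl; ≤-trans; toℕ-injective; injective⇒existsPivot)
open import Data.Product using (_×_; _,_; proj₁; proj₂)
open import Data.Sum using (inj₁; inj₂)
open import Function.Bundles using (Inverse; Injection)
open import Function.Properties.Inverse using (↔-refl; ↔-sym; Inverse⇒Injection)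
open import Relation.Binary.PropositionalEquality using (subst)

mono<⇒mono≤ : ∀ {m n} (f : Fin m → Fin n) → (∀ i j → i < j → f i ≤ f j) →
  ∀ {i j} → i ≤ j → f i ≤ f j
mono<⇒mono≤ f mono {i} {j} i≤j with ℕ.m≤n⇒m<n∨m≡n i≤j
... | inj₁ i<j = mono i j i<j
... | inj₂ i≡j rewrite toℕ-injective i≡j = ≤-refl {x = f j}

module _ {n : ℕ} {E : BipGraph n} (L : MonotoneLabelling E) where
  open MonotoneLabelling L

  matching⇒≤β : PerfectMatching E → ∀ i → i ≤ β i
  matching⇒≤β (σ , σ⊆E) i with injective⇒existsPivot (Injection.injective (Inverse⇒Injection σ)) i
  ... | j , j≤i , i≤σj = ≤-trans i≤σj (≤-trans σj≤βj (mono<⇒mono≤ β β-mono j≤i))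
    where
    σj≤βj : Inverse.to σ j ≤ β j
    σj≤βj = proj₂ (proj₁ (interval j (Inverse.to σ j)) (σ⊆E j))

  matching⇒α≤ : PerfectMatching E → ∀ i → α i ≤ i
  matching⇒α≤ (σ , σ⊆E) i with injective⇒existsPivot (Injection.injective (Inverse⇒Injection (↔-sym σ))) i
  ... | j , j≤i , i≤k = ≤-trans (mono<⇒mono≤ α α-mono i≤k) (≤-trans αk≤j j≤i)
    where
    open Inverse σ
    Ekj : E (from j) j
    Ekj = subst (E (from j)) (strictlyInverseˡ j) (σ⊆E (from j))
    αk≤j : α (from j) ≤ j
    αk≤j = proj₁ (proj₁ (interval (from j) j) Ekj)

  matching⇒diagonal : PerfectMatching E → ContainsDiagonal E
  matching⇒diagonal M i = proj₂ (interval i i) (matching⇒α≤ M i , matching⇒≤β M i)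

diagonal⇒matching : ∀ {n} {E : BipGraph n} → ContainsDiagonal E → PerfectMatching E
diagonal⇒matching diag = ↔-refl , diag

lemma12 : (n : ℕ) (E : BipGraph n) → MonotoneLabelling E →
    (PerfectMatching E → ContainsDiagonal E) × (ContainsDiagonal E → PerfectMatching E)
lemma12 n E L = matching⇒diagonal L , diagonal⇒matching {E = E}
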